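{- If the edge-biclique hypergraph $\mathcal{EB}(G)$ of a finite simple graph $G$ is Helly, then $G$ does not contain the triangular prism as an induced subgraph.
   Context: A biclique of $G$ is a vertex set $B\subseteq V(G)$ such that $G[B]$ is a complete bipartite graph and $B$ is inclusion-wise maximal with this property. The edge-biclique hypergraph $\mathcal{EB}(G)$ has vertex set $E(G)$ and its hyperedges are the edge sets $E(G[B])$ of the bicliques $B$ of $G$. A hypergraph is Helly if every subfamily of pairwise intersecting hyperedges has a nonempty common intersection. The triangular prism is the graph on vertices $a,b,c,d,e,f$ consisting of the triangles $abc$ and $def$ together with the edges $ad,be,cf$. -}

module Defs where

open import Data.Nat using (ℕ)
open import Data.Fin using (Fin; zero; suc)
open import Data.Fin.Subset using (Subset; _∈_; _∉_; _⊆_)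
open import Data.Bool using (Bool; true; false)
open import Data.Product using (Σ; _×_; ∃; ∃-syntax)
open import Data.Sum using (_⊎_)
open import Function.Definitions using (Injective)
open import Relation.Binary.PropositionalEquality using (_≡_)
open import Relation.Nullary using (¬_)

record Graph : Set where
  field
    n      : ℕ
    adj    : Fin n → Fin n → Bool
    sym    : ∀ u v → adj u v ≡ adj v u
    irrefl : ∀ v → adj v v ≡ false
open Graph public

module _ (G : Graph) where

  Vertex : Set
  Vertex = Fin (n G)

  VSet : Set
  VSet = Subset (n G)

  Adj : Vertex → Vertex → Set
  Adj u v = adj G u v ≡ true

  IsCompleteBipartite : VSet → Set
  IsCompleteBipartite B =
    Σ VSet λ X → Σ VSet λ Y →
      (∀ v → v ∈ B → v ∈ X ⊎ v ∈ Y) ×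
      (X ⊆ B) × (Y ⊆ B) ×
      (∀ v → v ∈ X → v ∉ Y) ×
      (∃[ x ] x ∈ X) × (∃[ y ] y ∈ Y) ×
      (∀ u v → u ∈ X → v ∈ X → ¬ Adj u v) ×
      (∀ u v → u ∈ Y → v ∈ Y → ¬ Adj u v) ×
      (∀ u v → u ∈ X → v ∈ Y → Adj u v)

  IsBiclique : VSet → Set
  IsBiclique B =
    IsCompleteBipartite B ×
    (∀ B′ → B ⊆ B′ → IsCompleteBipartite B′ → B′ ⊆ B)

  -- Edges of G, given by an (ordered) pair of adjacent endpoints;
  -- the edge {u,v} is represented by both (u,v) and (v,u).
  Edge : Set
  Edge = Σ Vertex λ u → Σ Vertex λ v → Adj u v

  _∈E[_] : Edge → VSet → Set
  (u Data.Product., v Data.Product., _) ∈E[ B ] = u ∈ B × v ∈ B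

  -- A subfamily of hyperedges is given by a predicate F on vertex sets
  -- that only holds of bicliques (the edge set E(G[B]) determines the
  -- biclique B, since both parts are nonempty).
  EBHelly : Set₁
  EBHelly =
    (F : VSet → Set) →
    (∀ B → F B → IsBiclique B) →
    (∃[ B ] F B) →
    (∀ B B′ → F B → F B′ → ∃[ e ] (e ∈E[ B ] × e ∈E[ B′ ])) →
    ∃[ e ] (∀ B → F B → e ∈E[ B ])

-- The triangular prism on Fin 6, vertices a,b,c,d,e,f = 0..5:
-- triangles abc, def and edges ad, be, cf.
prismAdj : Fin 6 → Fin 6 → Bool
prismAdj zero (suc zero) = true
prismAdj zero (suc (suc zero)) = true
prismAdj zero (suc (suc (suc zero))) = true
prismAdj (suc zero) zero = true
prismAdj (suc zero) (suc (suc zero)) = true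
prismAdj (suc zero) (suc (suc (suc (suc zero)))) = true
prismAdj (suc (suc zero)) zero = true
prismAdj (suc (suc zero)) (suc zero) = true
prismAdj (suc (suc zero)) (suc (suc (suc (suc (suc zero))))) = true
prismAdj (suc (suc (suc zero))) zero = true
prismAdj (suc (suc (suc zero))) (suc (suc (suc (suc zero)))) = true
prismAdj (suc (suc (suc zero))) (suc (suc (suc (suc (suc zero))))) = true
prismAdj (suc (suc (suc (suc zero)))) (suc zero) = true
prismAdj (suc (suc (suc (suc zero)))) (suc (suc (suc zero))) = true
prismAdj (suc (suc (suc (suc zero)))) (suc (suc (suc (suc (suc zero))))) = true
prismAdj (suc (suc (suc (suc (suc zero))))) (suc (suc zero)) = true
prismAdj (suc (suc (suc (suc (suc zero))))) (suc (suc (suc zero))) = true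
prismAdj (suc (suc (suc (suc (suc zero))))) (suc (suc (suc (suc zero)))) = true
prismAdj _ _ = false

HasInducedPrism : Graph → Set
HasInducedPrism G =
  Σ (Fin 6 → Fin (n G)) λ φ →
    Injective _≡_ _≡_ φ × (∀ i j → adj G (φ i) (φ j) ≡ prismAdj i j)

-- Each square abed, bcfe, acfd of the prism induces a C₄ = K₂,₂, which lies in a
-- biclique; these three bicliques pairwise share an edge (be, ad, cf), so Helly
-- gives a vertex u in all three. Inside a complete bipartite set adjacency is the
-- xor of the side bits, so along any of its edges xy, u is adjacent to exactly one
-- of x, y. Along the triangle abc this flips the bit "u ~ a" three times.
module Submission where

open import Defs hiding (sym)
open import Data.Bool using (Bool; true; false; not; _xor_)
open import Data.Bool.Properties using (¬-not; not-¬; not-involutive)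
open import Data.Empty using (⊥; ⊥-elim)
open import Data.Fin using (Fin; #_)
open import Data.Fin.Subset using (_∈_; _⊆_; _∪_; _∩_; ⁅_⁆)
open import Data.Fin.Subset.Properties
  using (x∈p∪q⁺; x∈p∪q⁻; x∈p∩q⁺; p∩q⊆p; p∩q⊆q; p⊆p∪q; q⊆p∪q; x∈⁅x⁆; x∈⁅y⁆⇒x≡y; ⊆-refl; ⊆-trans)
open import Data.List using (List; []; _∷_; allFin)
open import Data.List.Membership.Propositional using () renaming (_∈_ to _∈ₗ_)
open import Data.List.Membership.Propositional.Properties using (∈-allFin)
open import Data.List.Relation.Unary.Any using (here; there)
open import Data.Product using (_×_; _,_; proj₁; proj₂; swap; ∃-syntax)
open import Data.Sum using (_⊎_; inj₁; inj₂; [_,_]′)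
open import Function using (const)
open import Relation.Binary.PropositionalEquality using (_≡_; refl; sym; trans; cong; module ≡-Reasoning)
open import Relation.Nullary using (¬_; Dec; yes; no)
open import Relation.Nullary.Decidable using (¬¬-excluded-middle)
open import Relation.Nullary.Negation using (DoubleNegation; ¬¬-map)

xor-flip : ∀ a b c → b xor c ≡ true → a xor b ≡ not (a xor c)
xor-flip true  true  false _ = refl
xor-flip true  false true  _ = refl
xor-flip false true  false _ = refl
xor-flip false false true  _ = refl
xor-flip _     true  true  ()
xor-flip _     false false ()

∈pair⁻ : ∀ {m} {v x y : Fin m} → v ∈ ⁅ x ⁆ ∪ ⁅ y ⁆ → v ≡ x ⊎ v ≡ y
∈pair⁻ {x = x} {y} v∈ with x∈p∪q⁻ ⁅ x ⁆ ⁅ y ⁆ v∈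
... | inj₁ v∈x = inj₁ (x∈⁅y⁆⇒x≡y x v∈x)
... | inj₂ v∈y = inj₂ (x∈⁅y⁆⇒x≡y y v∈y)

module _ (G : Graph) where

  private
    CB : VSet G → Set
    CB = IsCompleteBipartite G

    _~_ : Vertex G → Vertex G → Set
    _~_ = Adj G

  ~-sym : ∀ {u v} → u ~ v → v ~ u
  ~-sym {u} {v} u~v = trans (Graph.sym G v u) u~v

  ~-irrefl : ∀ {v} → ¬ v ~ v
  ~-irrefl {v} v~v with trans (sym v~v) (irrefl G v)
  ... | ()

  sideIn : ∀ {B} → CB B → ∀ {v} → v ∈ B → Bool
  sideIn (_ , _ , cover , _) v∈B = [ const false , const true ]′ (cover _ v∈B)

  adj≡xor-sides : ∀ {B} (cb : CB B) {u v} (u∈B : u ∈ B) (v∈B : v ∈ B) →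
                  adj G u v ≡ sideIn cb u∈B xor sideIn cb v∈B
  adj≡xor-sides (X , Y , cover , _ , _ , _ , _ , _ , indX , indY , complete) {u} {v} u∈B v∈B
    with cover u u∈B | cover v v∈B
  ... | inj₁ u∈X | inj₁ v∈X = ¬-not (indX u v u∈X v∈X)
  ... | inj₁ u∈X | inj₂ v∈Y = complete u v u∈X v∈Y
  ... | inj₂ u∈Y | inj₁ v∈X = ~-sym (complete v u v∈X u∈Y)
  ... | inj₂ u∈Y | inj₂ v∈Y = ¬-not (indY u v u∈Y v∈Y)

  adj-flip : ∀ {B u x y} → CB B → u ∈ B → x ∈ B → y ∈ B → x ~ y →
             adj G u x ≡ not (adj G u y)
  adj-flip cb u∈B x∈B y∈B x~y = begin
    adj G _ _                 ≡⟨ adj≡xor-sides cb u∈B x∈B ⟩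
    su xor sideIn cb x∈B      ≡⟨ xor-flip su _ _ (trans (sym (adj≡xor-sides cb x∈B y∈B)) x~y) ⟩
    not (su xor sideIn cb y∈B) ≡⟨ cong not (sym (adj≡xor-sides cb u∈B y∈B)) ⟩
    not (adj G _ _)           ∎
    where
      open ≡-Reasoning
      su : Bool
      su = sideIn cb u∈B

  no-common-vertex-over-triangle :
    ∀ {a b c u B₁ B₂ B₃} → a ~ b → b ~ c → a ~ c →
    CB B₁ → a ∈ B₁ → b ∈ B₁ → CB B₂ → b ∈ B₂ → c ∈ B₂ → CB B₃ → a ∈ B₃ → c ∈ B₃ →
    u ∈ B₁ → u ∈ B₂ → u ∈ B₃ → ⊥
  no-common-vertex-over-triangle {a} {b} {c} {u} a~b b~c a~c
    cb₁ a∈₁ b∈₁ cb₂ b∈₂ c∈₂ cb₃ a∈₃ c∈₃ u∈₁ u∈₂ u∈₃ =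
    not-¬ u~a≡u~c (adj-flip cb₃ u∈₃ a∈₃ c∈₃ a~c)
    where
      open ≡-Reasoning
      u~a≡u~c : adj G u a ≡ adj G u c
      u~a≡u~c = begin
        adj G u a             ≡⟨ adj-flip cb₁ u∈₁ a∈₁ b∈₁ a~b ⟩
        not (adj G u b)       ≡⟨ cong not (adj-flip cb₂ u∈₂ b∈₂ c∈₂ b~c) ⟩
        not (not (adj G u c)) ≡⟨ not-involutive _ ⟩
        adj G u c             ∎

  complete-bipartite-convex : ∀ {B C S} → CB B → CB C → C ⊆ S → S ⊆ B → CB S
  complete-bipartite-convex {S = S} (X , Y , cover , _ , _ , disjoint , _ , _ , indX , indY , complete)
    (_ , _ , _ , XC⊆C , YC⊆C , _ , (x , x∈XC) , (y , y∈YC) , _ , _ , completeC) C⊆S S⊆B =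
    X ∩ S , Y ∩ S , cover′ , p∩q⊆q X S , p∩q⊆q Y S ,
    (λ v v∈X v∈Y → disjoint v (inX v∈X) (inY v∈Y)) ,
    proj₁ straddle , proj₂ straddle ,
    (λ u v u∈X v∈X → indX u v (inX u∈X) (inX v∈X)) ,
    (λ u v u∈Y v∈Y → indY u v (inY u∈Y) (inY v∈Y)) ,
    (λ u v u∈X v∈Y → complete u v (inX u∈X) (inY v∈Y))
    where
      inX : X ∩ S ⊆ X
      inX = p∩q⊆p X S
      inY : Y ∩ S ⊆ Y
      inY = p∩q⊆p Y S
      x∈S : x ∈ S
      x∈S = C⊆S (XC⊆C x∈XC)
      y∈S : y ∈ S
      y∈S = C⊆S (YC⊆C y∈YC)
      x~y : x ~ y
      x~y = completeC x y x∈XC y∈YC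

      cover′ : ∀ v → v ∈ S → v ∈ X ∩ S ⊎ v ∈ Y ∩ S
      cover′ v v∈S with cover v (S⊆B v∈S)
      ... | inj₁ v∈X = inj₁ (x∈p∩q⁺ (v∈X , v∈S))
      ... | inj₂ v∈Y = inj₂ (x∈p∩q⁺ (v∈Y , v∈S))

      straddle : (∃[ p ] p ∈ X ∩ S) × (∃[ q ] q ∈ Y ∩ S)
      straddle with cover x (S⊆B x∈S) | cover y (S⊆B y∈S)
      ... | inj₁ x∈X | inj₁ y∈X = ⊥-elim (indX x y x∈X y∈X x~y)
      ... | inj₁ x∈X | inj₂ y∈Y = (x , x∈p∩q⁺ (x∈X , x∈S)) , (y , x∈p∩q⁺ (y∈Y , y∈S))
      ... | inj₂ x∈Y | inj₁ y∈X = (y , x∈p∩q⁺ (y∈X , y∈S)) , (x , x∈p∩q⁺ (x∈Y , x∈S))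
      ... | inj₂ x∈Y | inj₂ y∈Y = ⊥-elim (indY x y x∈Y y∈Y x~y)

  Saturated : VSet G → List (Vertex G) → Set
  Saturated B ws = ∀ B′ → B ⊆ B′ → CB B′ → ∀ {w} → w ∈ₗ ws → w ∈ B′ → w ∈ B

  saturate-step : ∀ {B w ws} → CB B → Saturated B ws → Dec (CB (B ∪ ⁅ w ⁆)) →
                  ∃[ B′ ] (B ⊆ B′ × CB B′ × Saturated B′ (w ∷ ws))
  saturate-step {B} {w} _ sat (yes cb∪) = B ∪ ⁅ w ⁆ , p⊆p∪q _ , cb∪ , sat∪
    where
      sat∪ : Saturated (B ∪ ⁅ w ⁆) (w ∷ _)
      sat∪ _ _ _ (here refl) _ = q⊆p∪q B _ (x∈⁅x⁆ w)
      sat∪ B′ B∪w⊆B′ cb′ (there v∈ws) v∈B′ =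
        p⊆p∪q _ (sat B′ (⊆-trans (p⊆p∪q _) B∪w⊆B′) cb′ v∈ws v∈B′)
  saturate-step {B} {w} cb sat (no ¬cb∪) = B , ⊆-refl , cb , sat′
    where
      sat′ : Saturated B (w ∷ _)
      sat′ B′ B⊆B′ cb′ (here refl) w∈B′ =
        ⊥-elim (¬cb∪ (complete-bipartite-convex cb′ cb (p⊆p∪q _) B∪w⊆B′))
        where
          B∪w⊆B′ : B ∪ ⁅ w ⁆ ⊆ B′
          B∪w⊆B′ v∈ with x∈p∪q⁻ B ⁅ w ⁆ v∈
          ... | inj₁ v∈B = B⊆B′ v∈B
          ... | inj₂ v∈w rewrite x∈⁅y⁆⇒x≡y w v∈w = w∈B′
      sat′ B′ B⊆B′ cb′ (there v∈ws) = sat B′ B⊆B′ cb′ v∈ws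

  -- Whether B ∪ ⁅ w ⁆ is complete bipartite is not decided constructively, so the
  -- greedy extension is only obtained under double negation; that suffices for ⊥.
  saturate : ∀ {C} ws → CB C → DoubleNegation (∃[ B ] (C ⊆ B × CB B × Saturated B ws))
  saturate {C} [] cb ¬ext = ¬ext (C , ⊆-refl , cb , λ _ _ _ ())
  saturate (w ∷ ws) cb ¬ext = saturate ws cb λ (B , C⊆B , cbB , sat) →
    ¬¬-excluded-middle λ cb∪? →
      let (B′ , B⊆B′ , cbB′ , sat′) = saturate-step cbB sat cb∪?
      in ¬ext (B′ , ⊆-trans C⊆B B⊆B′ , cbB′ , sat′)

  extend-to-biclique : ∀ {C} → CB C → DoubleNegation (∃[ B ] (C ⊆ B × IsBiclique G B))
  extend-to-biclique cb = ¬¬-map maximal (saturate (allFin _) cb)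
    where
      maximal : ∀ {C} → ∃[ B ] (C ⊆ B × CB B × Saturated B (allFin _)) → ∃[ B ] (C ⊆ B × IsBiclique G B)
      maximal (B , C⊆B , cbB , sat) = B , C⊆B , cbB , λ B′ B⊆B′ cb′ → sat B′ B⊆B′ cb′ (∈-allFin _)

  cycle₄ : Vertex G → Vertex G → Vertex G → Vertex G → VSet G
  cycle₄ p q r s = (⁅ p ⁆ ∪ ⁅ r ⁆) ∪ (⁅ q ⁆ ∪ ⁅ s ⁆)

  ∈cycle₄ : ∀ p q r s → let C = cycle₄ p q r s in p ∈ C × q ∈ C × r ∈ C × s ∈ C
  ∈cycle₄ p q r s =
    p⊆p∪q _ (p⊆p∪q _ (x∈⁅x⁆ p)) , q⊆p∪q _ _ (p⊆p∪q _ (x∈⁅x⁆ q)) ,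
    p⊆p∪q _ (q⊆p∪q _ _ (x∈⁅x⁆ r)) , q⊆p∪q _ _ (q⊆p∪q _ _ (x∈⁅x⁆ s))

  pair-independent : ∀ {x y} → ¬ x ~ y → ∀ u v → u ∈ ⁅ x ⁆ ∪ ⁅ y ⁆ → v ∈ ⁅ x ⁆ ∪ ⁅ y ⁆ → ¬ u ~ v
  pair-independent x≁y u v u∈ v∈ with ∈pair⁻ u∈ | ∈pair⁻ v∈
  ... | inj₁ refl | inj₁ refl = ~-irrefl
  ... | inj₁ refl | inj₂ refl = x≁y
  ... | inj₂ refl | inj₁ refl = λ y~x → x≁y (~-sym y~x)
  ... | inj₂ refl | inj₂ refl = ~-irrefl

  induced-cycle₄-complete-bipartite : ∀ {p q r s} → p ~ q → q ~ r → r ~ s → s ~ p →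
                                      ¬ p ~ r → ¬ q ~ s → CB (cycle₄ p q r s)
  induced-cycle₄-complete-bipartite {p} {q} {r} {s} p~q q~r r~s s~p p≁r q≁s =
    X , Y , (λ v → x∈p∪q⁻ X Y) , p⊆p∪q Y , q⊆p∪q X Y ,
    (λ v v∈X v∈Y → ~-irrefl (complete v v v∈X v∈Y)) ,
    (p , x∈p∪q⁺ (inj₁ (x∈⁅x⁆ p))) , (q , x∈p∪q⁺ (inj₁ (x∈⁅x⁆ q))) ,
    pair-independent p≁r , pair-independent q≁s , complete
    where
      X Y : VSet G
      X = ⁅ p ⁆ ∪ ⁅ r ⁆
      Y = ⁅ q ⁆ ∪ ⁅ s ⁆
      complete : ∀ u v → u ∈ X → v ∈ Y → u ~ v
      complete u v u∈X v∈Y with ∈pair⁻ u∈X | ∈pair⁻ v∈Y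
      ... | inj₁ refl | inj₁ refl = p~q
      ... | inj₁ refl | inj₂ refl = ~-sym s~p
      ... | inj₂ refl | inj₁ refl = ~-sym q~r
      ... | inj₂ refl | inj₂ refl = r~s

  SharesEdge : VSet G → VSet G → Set
  SharesEdge B B′ = ∃[ e ] (_∈E[_] G e B × _∈E[_] G e B′)

  helly-three : ∀ {B₁ B₂ B₃} → EBHelly G →
                IsBiclique G B₁ → IsBiclique G B₂ → IsBiclique G B₃ →
                SharesEdge B₁ B₂ → SharesEdge B₁ B₃ → SharesEdge B₂ B₃ →
                ∃[ e ] (_∈E[_] G e B₁ × _∈E[_] G e B₂ × _∈E[_] G e B₃)
  helly-three {B₁} {B₂} {B₃} helly bic₁ bic₂ bic₃ s₁₂ s₁₃ s₂₃ =
    let (e , e∈all) = helly Family biclique (B₁ , inj₁ refl) pairwise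
    in e , e∈all B₁ (inj₁ refl) , e∈all B₂ (inj₂ (inj₁ refl)) , e∈all B₃ (inj₂ (inj₂ refl))
    where
      Family : VSet G → Set
      Family B = B ≡ B₁ ⊎ B ≡ B₂ ⊎ B ≡ B₃

      biclique : ∀ B → Family B → IsBiclique G B
      biclique _ (inj₁ refl)        = bic₁
      biclique _ (inj₂ (inj₁ refl)) = bic₂
      biclique _ (inj₂ (inj₂ refl)) = bic₃

      left : ∀ {B B′} → SharesEdge B B′ → SharesEdge B B
      left (e , e∈B , _) = e , e∈B , e∈B

      flip : ∀ {B B′} → SharesEdge B B′ → SharesEdge B′ B
      flip (e , e∈B) = e , swap e∈B

      pairwise : ∀ B B′ → Family B → Family B′ → SharesEdge B B′
      pairwise _ _ (inj₁ refl)        (inj₁ refl)        = left s₁₂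
      pairwise _ _ (inj₁ refl)        (inj₂ (inj₁ refl)) = s₁₂
      pairwise _ _ (inj₁ refl)        (inj₂ (inj₂ refl)) = s₁₃
      pairwise _ _ (inj₂ (inj₁ refl)) (inj₁ refl)        = flip s₁₂
      pairwise _ _ (inj₂ (inj₁ refl)) (inj₂ (inj₁ refl)) = left s₂₃
      pairwise _ _ (inj₂ (inj₁ refl)) (inj₂ (inj₂ refl)) = s₂₃
      pairwise _ _ (inj₂ (inj₂ refl)) (inj₁ refl)        = flip s₁₃
      pairwise _ _ (inj₂ (inj₂ refl)) (inj₂ (inj₁ refl)) = flip s₂₃
      pairwise _ _ (inj₂ (inj₂ refl)) (inj₂ (inj₂ refl)) = left (flip s₁₃)

module Prism (G : Graph) (φ : Fin 6 → Vertex G)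
             (induced : ∀ i j → adj G (φ i) (φ j) ≡ prismAdj i j) where

  a b c d e f : Fin 6
  a = # 0
  b = # 1
  c = # 2
  d = # 3
  e = # 4
  f = # 5

  edge : ∀ i j → prismAdj i j ≡ true → Adj G (φ i) (φ j)
  edge i j i~j = trans (induced i j) i~j

  non-edge : ∀ i j → prismAdj i j ≡ false → ¬ Adj G (φ i) (φ j)
  non-edge i j i≁j i~j with trans (sym i~j) (trans (induced i j) i≁j)
  ... | ()

  face : Fin 6 → Fin 6 → Fin 6 → Fin 6 → VSet G
  face i j k l = cycle₄ G (φ i) (φ j) (φ k) (φ l)

  face-complete-bipartite :
    ∀ i j k l → prismAdj i j ≡ true → prismAdj j k ≡ true → prismAdj k l ≡ true →
    prismAdj l i ≡ true → prismAdj i k ≡ false → prismAdj j l ≡ false →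
    IsCompleteBipartite G (face i j k l)
  face-complete-bipartite i j k l ij jk kl li ik jl =
    induced-cycle₄-complete-bipartite G (edge i j ij) (edge j k jk) (edge k l kl) (edge l i li)
      (non-edge i k ik) (non-edge j l jl)

  face⊆⇒∈ : ∀ i j k l {B} → face i j k l ⊆ B → φ i ∈ B × φ j ∈ B × φ k ∈ B × φ l ∈ B
  face⊆⇒∈ i j k l face⊆B =
    let (i∈ , j∈ , k∈ , l∈) = ∈cycle₄ G (φ i) (φ j) (φ k) (φ l)
    in face⊆B i∈ , face⊆B j∈ , face⊆B k∈ , face⊆B l∈

  ¬helly-bicliques-over-faces :
    EBHelly G → ∀ {B₁ B₂ B₃} →
    IsBiclique G B₁ → face a b e d ⊆ B₁ →
    IsBiclique G B₂ → face b c f e ⊆ B₂ →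
    IsBiclique G B₃ → face a c f d ⊆ B₃ → ⊥
  ¬helly-bicliques-over-faces helly bic₁ abed⊆B₁ bic₂ bcfe⊆B₂ bic₃ acfd⊆B₃ =
    let (a∈₁ , b∈₁ , e∈₁ , d∈₁) = face⊆⇒∈ a b e d abed⊆B₁
        (b∈₂ , c∈₂ , f∈₂ , e∈₂) = face⊆⇒∈ b c f e bcfe⊆B₂
        (a∈₃ , c∈₃ , f∈₃ , d∈₃) = face⊆⇒∈ a c f d acfd⊆B₃
        ((u , _) , (u∈₁ , _) , (u∈₂ , _) , (u∈₃ , _)) =
          helly-three G helly bic₁ bic₂ bic₃
            ((φ b , φ e , edge b e refl) , (b∈₁ , e∈₁) , (b∈₂ , e∈₂))
            ((φ a , φ d , edge a d refl) , (a∈₁ , d∈₁) , (a∈₃ , d∈₃))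
            ((φ c , φ f , edge c f refl) , (c∈₂ , f∈₂) , (c∈₃ , f∈₃))
    in no-common-vertex-over-triangle G (edge a b refl) (edge b c refl) (edge a c refl)
         (proj₁ bic₁) a∈₁ b∈₁ (proj₁ bic₂) b∈₂ c∈₂ (proj₁ bic₃) a∈₃ c∈₃ u∈₁ u∈₂ u∈₃

lemma7 : (G : Graph) → EBHelly G → ¬ HasInducedPrism G
lemma7 G helly (φ , _ , induced) =
  extend-to-biclique G (face-complete-bipartite a b e d refl refl refl refl refl refl)
    λ (B₁ , abed⊆B₁ , bic₁) →
  extend-to-biclique G (face-complete-bipartite b c f e refl refl refl refl refl refl)
    λ (B₂ , bcfe⊆B₂ , bic₂) →
  extend-to-biclique G (face-complete-bipartite a c f d refl refl refl refl refl refl)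
    λ (B₃ , acfd⊆B₃ , bic₃) →
  ¬helly-bicliques-over-faces helly bic₁ abed⊆B₁ bic₂ bcfe⊆B₂ bic₃ acfd⊆B₃
  where open Prism G φ induced
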